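{- Let $k\geq 5$. If $k\neq 6$, then $d^*(C_k)=c^*(C_k)=2$; moreover $c^*(C_6)=d^*(C_6)+1=3$.
   Context: $C_k$ is the (loopless) cycle on $k$ vertices; $N(v)$ is the neighborhood of $v$; vertices $u,v$ are incomparable if neither $N(u)\subseteq N(v)$ nor $N(v)\subseteq N(u)$. A set $S$ has a common neighbor in $L$ if some vertex of $L$ is adjacent to all vertices of $S$. For a graph $H$, $c^*(H)$ is the maximum over $L\subseteq V(H)$ of the largest size of an inclusion-minimal $S\subseteq V(H)$ without a common neighbor in $L$. A lower bound structure of order $d$: a set $L\subseteq V(H)$, distinct $x_1,\dots,x_d$, not necessarily distinct $x_1',\dots,x_d'$ with $x_i,x_i'$ incomparable, $\bigcap_i N(x_i)\cap L=\emptyset$, and $\bigcap_i N(y_i)\cap L\ne\emptyset$ for every choice $y_i\in\{x_i,x_i'\}$ with at least one $y_i=x_i'$. $d^*(H)$ is the largest order of a lower bound structure in $H$. -}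

module Defs where

open import Data.Nat using (ℕ; zero; suc; _≤_)
open import Data.Fin using (Fin; toℕ)
open import Data.Fin.Subset using (Subset; _∈_; _⊂_; ∣_∣)
open import Data.Bool using (Bool; true; false; if_then_else_)
open import Data.Product using (Σ; ∃; _×_; _,_)
open import Data.Sum using (_⊎_)
open import Relation.Nullary using (¬_)
open import Relation.Binary.PropositionalEquality using (_≡_)
open import Function.Definitions using (Injective)

Graph : ℕ → Set₁
Graph n = Fin n → Fin n → Set

-- The cycle C_k on vertices 0,…,k-1: i ~ j iff j = i+1 or i = j+1 (mod k).
-- (Meant for k ≥ 3, where it is a simple loopless cycle.)
Cycle : (k : ℕ) → Graph k
Cycle k i j =
  (toℕ j ≡ suc (toℕ i)) ⊎ (toℕ i ≡ suc (toℕ j))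
  ⊎ ((toℕ i ≡ 0 × suc (toℕ j) ≡ k) ⊎ (toℕ j ≡ 0 × suc (toℕ i) ≡ k))

module _ {n : ℕ} (G : Graph n) where

  NbhdSub : Fin n → Fin n → Set
  NbhdSub u v = ∀ w → G u w → G v w

  Incomparable : Fin n → Fin n → Set
  Incomparable u v = ¬ NbhdSub u v × ¬ NbhdSub v u

  HasCommonNeighbor : Subset n → Subset n → Set
  HasCommonNeighbor S L = ∃ λ w → w ∈ L × (∀ s → s ∈ S → G w s)

  MinimalNoCommonNeighbor : Subset n → Subset n → Set
  MinimalNoCommonNeighbor S L =
    ¬ HasCommonNeighbor S L × (∀ T → T ⊂ S → HasCommonNeighbor T L)

  CStarIs : ℕ → Set
  CStarIs m =
    (∃ λ L → ∃ λ S → MinimalNoCommonNeighbor S L × ∣ S ∣ ≡ m)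
    × (∀ L S → MinimalNoCommonNeighbor S L → ∣ S ∣ ≤ m)

  CommonNbrInL : {d : ℕ} → (Fin d → Fin n) → Subset n → Set
  CommonNbrInL y L = ∃ λ w → w ∈ L × (∀ i → G (y i) w)

  LowerBoundStructure : ℕ → Set
  LowerBoundStructure d =
    Σ (Subset n) λ L →
    Σ (Fin d → Fin n) λ x →
    Σ (Fin d → Fin n) λ x' →
      Injective _≡_ _≡_ x
      × (∀ i → Incomparable (x i) (x' i))
      × ¬ CommonNbrInL x L
      × (∀ (c : Fin d → Bool) → (∃ λ i → c i ≡ true) →
           CommonNbrInL (λ i → if c i then x' i else x i) L)

  DStarIs : ℕ → Set
  DStarIs m = LowerBoundStructure m × (∀ d → LowerBoundStructure d → d ≤ m)

-- Every vertex of C_k has exactly two neighbours.  Hence an inclusion-minimal S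
-- without a common neighbour in L has at most three elements, since S minus any
-- vertex has a common neighbour; and a lower bound structure has order at most
-- two, since among the flips of three positions some flip puts three distinct
-- vertices into the neighbourhood of one vertex.  Three distinct vertices that
-- pairwise share a neighbour are pairwise at distance two, so they close a walk
-- of length six and k divides 6; this gives |S| ≤ 2 unless k = 6.  The matching
-- lower bounds are explicit: L = {1,3}, x = (0,4), x' = (2,2) and L = {0,3},
-- S = {1,2} on C_k, and L = {1,3,5}, S = {0,2,4} on C_6.
module Submission where

open import Defs
open import Data.Bool using (Bool; true; false; if_then_else_)
open import Data.Empty using (⊥; ⊥-elim)
open import Data.Fin using (Fin; zero; suc; toℕ; fromℕ; #_)
open import Data.Fin.Properties using (toℕ-injective; toℕ<n; toℕ-fromℕ)
open import Data.Fin.Subset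
  using (Subset; _∈_; _∉_; _⊂_; ∣_∣; inside; outside; _─_; _-_; ⁅_⁆; Nonempty)
  renaming (⊥ to ∅)
open import Data.Fin.Subset.Properties
  using (p─q⊆p; p─⊥≡p; x∉⁅y⁆⇒x≢y; x∈p⇒p-x⊂p; x∈p∧x≢y⇒x∈p-y; ∉⊥; ∣⊥∣≡0)
open import Data.Nat using (ℕ; zero; suc; _+_; _*_; _≤_; _<_; _≟_; z≤n; s≤s; s≤s⁻¹)
open import Data.Nat.Divisibility using (_∣_; divides; _∣?_; >⇒∤)
open import Data.Nat.Properties
  using ( +-commutativeSemigroup; ≮⇒≥; ≤-trans; +-assoc; +-comm; +-cancelˡ-≡
        ; *-distribʳ-+; +-identityʳ; suc-injective; <-irrefl; m≤m+n; m≤n⇒∃[o]m+o≡n)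
open import Algebra.Properties.CommutativeSemigroup +-commutativeSemigroup
  using (xy∙z≈xz∙y)
open import Data.Product using (∃; _×_; _,_)
open import Data.Sum using (_⊎_; inj₁; inj₂)
open import Data.Vec.Base using ([]; _∷_; here; there)
open import Function using (_∘_)
open import Relation.Binary using (Decidable)
open import Relation.Binary.PropositionalEquality
  using (_≡_; _≢_; refl; sym; trans; cong; subst; ≢-sym; module ≡-Reasoning)
open import Relation.Nullary using (¬_; contradiction)
open import Relation.Nullary.Decidable using (_×-dec_; _⊎-dec_; from-yes; from-no)

SomeTwoEqual : {A : Set} → A → A → A → Set
SomeTwoEqual a b c = a ≡ b ⊎ b ≡ c ⊎ a ≡ c

distinct⇒¬SomeTwoEqual : {A : Set} {a b c : A} → a ≢ b → b ≢ c → a ≢ c → ¬ SomeTwoEqual a b c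
distinct⇒¬SomeTwoEqual a≢b _ _ (inj₁ a≡b) = a≢b a≡b
distinct⇒¬SomeTwoEqual _ b≢c _ (inj₂ (inj₁ b≡c)) = b≢c b≡c
distinct⇒¬SomeTwoEqual _ _ a≢c (inj₂ (inj₂ a≡c)) = a≢c a≡c

AtMostTwo : {A : Set} → (A → Set) → Set
AtMostTwo P = ∀ {a b c} → P a → P b → P c → SomeTwoEqual a b c

x∈p─q⇒x∉q : ∀ {n} {p q : Subset n} {x} → x ∈ p ─ q → x ∉ q
x∈p─q⇒x∉q {p = _ ∷ _} {inside ∷ _} {zero} ()
x∈p─q⇒x∉q {p = _ ∷ _} {outside ∷ _} {zero} _ ()
x∈p─q⇒x∉q {p = _ ∷ _} {_ ∷ _} {suc _} (there x∈p─q) (there x∈q) = x∈p─q⇒x∉q x∈p─q x∈q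

x∈p-y⇒x≢y : ∀ {n} {p : Subset n} {x y} → x ∈ p - y → x ≢ y
x∈p-y⇒x≢y = x∉⁅y⁆⇒x≢y ∘ x∈p─q⇒x∉q

x∈p-y⇒x∈p : ∀ {n} {p : Subset n} {x y} → x ∈ p - y → x ∈ p
x∈p-y⇒x∈p {p = p} {y = y} = p─q⊆p p ⁅ y ⁆

suc∣p-x∣≡∣p∣ : ∀ {n} {p : Subset n} {x} → x ∈ p → suc ∣ p - x ∣ ≡ ∣ p ∣
suc∣p-x∣≡∣p∣ {p = inside ∷ p} here = cong (suc ∘ ∣_∣) (p─⊥≡p p)
suc∣p-x∣≡∣p∣ {p = inside ∷ _} (there x∈p) = cong suc (suc∣p-x∣≡∣p∣ x∈p)
suc∣p-x∣≡∣p∣ {p = outside ∷ _} (there x∈p) = suc∣p-x∣≡∣p∣ x∈p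

∣p∣>0⇒Nonempty : ∀ {n} {p : Subset n} → 0 < ∣ p ∣ → Nonempty p
∣p∣>0⇒Nonempty {p = inside ∷ _} _ = zero , here
∣p∣>0⇒Nonempty {p = outside ∷ _} 0<∣p∣ =
  let x , x∈p = ∣p∣>0⇒Nonempty 0<∣p∣ in suc x , there x∈p

pick-element : ∀ {n m} {p : Subset n} → suc m ≤ ∣ p ∣ → ∃ λ x → x ∈ p × m ≤ ∣ p - x ∣
pick-element {p = p} m<∣p∣ =
  let x , x∈p = ∣p∣>0⇒Nonempty (≤-trans (s≤s z≤n) m<∣p∣)
  in x , x∈p , s≤s⁻¹ (subst (_ ≤_) (sym (suc∣p-x∣≡∣p∣ x∈p)) m<∣p∣)

record DistinctTriple {n : ℕ} (p : Subset n) : Set where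
  constructor distinctTriple
  field
    {a b c} : Fin n
    a∈p : a ∈ p
    b∈p : b ∈ p
    c∈p : c ∈ p
    a≢b : a ≢ b
    b≢c : b ≢ c
    a≢c : a ≢ c

3≤∣p∣⇒DistinctTriple : ∀ {n} {p : Subset n} → 3 ≤ ∣ p ∣ → DistinctTriple p
3≤∣p∣⇒DistinctTriple 3≤∣p∣ =
  let a , a∈p , 2≤∣p-a∣ = pick-element 3≤∣p∣
      b , b∈p-a , 1≤∣p-a-b∣ = pick-element 2≤∣p-a∣
      c , c∈p-a-b , _ = pick-element 1≤∣p-a-b∣
      c∈p-a = x∈p-y⇒x∈p c∈p-a-b
  in distinctTriple a∈p (x∈p-y⇒x∈p b∈p-a) (x∈p-y⇒x∈p c∈p-a)
       (≢-sym (x∈p-y⇒x≢y b∈p-a)) (≢-sym (x∈p-y⇒x≢y c∈p-a-b)) (≢-sym (x∈p-y⇒x≢y c∈p-a))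

module _ {n : ℕ} (G : Graph n) where

  CommonNeighbour : Fin n → Fin n → Set
  CommonNeighbour a b = ∃ λ w → G w a × G w b

  PairwiseCommonNeighbours : Fin n → Fin n → Fin n → Set
  PairwiseCommonNeighbours a b c = CommonNeighbour a b × CommonNeighbour b c × CommonNeighbour a c

  private-neighbour⇒¬NbhdSub : ∀ {u v w} → G u w → ¬ G v w → ¬ NbhdSub G u v
  private-neighbour⇒¬NbhdSub u~w v≁w N[u]⊆N[v] = v≁w (N[u]⊆N[v] _ u~w)

  minimal-from-witnesses : ∀ {S L : Subset n}
    → (∀ {w} → w ∈ L → ∃ λ s → s ∈ S × ¬ G w s)
    → (∀ {y} → y ∈ S → ∃ λ w → w ∈ L × (∀ {s} → s ∈ S → s ≢ y → G w s))
    → MinimalNoCommonNeighbor G S L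
  minimal-from-witnesses non-neighbour in-L-neighbour = no-common , proper-common
    where
    no-common : ¬ HasCommonNeighbor G _ _
    no-common (w , w∈L , w~S) = let s , s∈S , w≁s = non-neighbour w∈L in w≁s (w~S s s∈S)
    proper-common : ∀ T → T ⊂ _ → HasCommonNeighbor G T _
    proper-common T (T⊆S , y , y∈S , y∉T) =
      let w , w∈L , w~S-y = in-L-neighbour y∈S
      in w , w∈L , λ s s∈T → w~S-y (T⊆S s∈T) λ { refl → y∉T s∈T }

  minimal⇒punctured-common-neighbour : ∀ {S L} {x} → MinimalNoCommonNeighbor G S L → x ∈ S
    → ∃ λ w → ∀ {s} → s ∈ S → s ≢ x → G w s
  minimal⇒punctured-common-neighbour (_ , proper-common) x∈S =
    let w , _ , w~S-x = proper-common _ (x∈p⇒p-x⊂p x∈S)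
    in w , λ s∈S s≢x → w~S-x _ (x∈p∧x≢y⇒x∈p-y s∈S s≢x)

  minimal-size≤3 : (∀ w → AtMostTwo (G w)) → ∀ L S → MinimalNoCommonNeighbor G S L → ∣ S ∣ ≤ 3
  minimal-size≤3 degree≤2 L S minimal = ≮⇒≥ λ 3<∣S∣ →
    let x , x∈S , 3≤∣S-x∣ = pick-element {p = S} 3<∣S∣
        open DistinctTriple (3≤∣p∣⇒DistinctTriple {p = S - x} 3≤∣S-x∣)
        w , w~S-x = minimal⇒punctured-common-neighbour minimal x∈S
        w~ : ∀ {s} → s ∈ S - x → G w s
        w~ s∈S-x = w~S-x (x∈p-y⇒x∈p s∈S-x) (x∈p-y⇒x≢y s∈S-x)
    in distinct⇒¬SomeTwoEqual a≢b b≢c a≢c (degree≤2 w (w~ a∈p) (w~ b∈p) (w~ c∈p))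

  minimal-size≤2 : (∀ {a b c} → a ≢ b → b ≢ c → a ≢ c → ¬ PairwiseCommonNeighbours a b c)
    → ∀ L S → MinimalNoCommonNeighbor G S L → ∣ S ∣ ≤ 2
  minimal-size≤2 no-triangle L S minimal = ≮⇒≥ λ 2<∣S∣ →
    let open DistinctTriple (3≤∣p∣⇒DistinctTriple {p = S} 2<∣S∣)
    in no-triangle a≢b b≢c a≢c
         ( common a∈p b∈p c∈p a≢c b≢c
         , common b∈p c∈p a∈p (≢-sym a≢b) (≢-sym a≢c)
         , common a∈p c∈p b∈p a≢b (≢-sym b≢c))
    where
    common : ∀ {a b c} → a ∈ S → b ∈ S → c ∈ S → a ≢ c → b ≢ c → CommonNeighbour a b
    common a∈S b∈S c∈S a≢c b≢c =
      let w , w~S-c = minimal⇒punctured-common-neighbour minimal c∈S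
      in w , w~S-c a∈S a≢c , w~S-c b∈S b≢c

-- A single flip forces x'ᵢ to equal some other xⱼ, giving a fixed-point-free
-- map on three positions.  Such a map contains a transposition or is a 3-cycle,
-- and flipping exactly its support produces three distinct entries.
no-three-flips : {A : Set} (a b c a' b' c' : A) → a ≢ b → b ≢ c → a ≢ c
  → SomeTwoEqual a' b c → SomeTwoEqual a b' c → SomeTwoEqual a b c'
  → SomeTwoEqual a' b' c → SomeTwoEqual a' b c' → SomeTwoEqual a b' c'
  → SomeTwoEqual a' b' c' → ⊥
no-three-flips a b c a' b' c' a≢b b≢c a≢c t₀ t₁ t₂ t₀₁ t₀₂ t₁₂ t₀₁₂ =
  cases (flip₀ t₀) (flip₁ t₁) (flip₂ t₂)
  where
  flip₀ : SomeTwoEqual a' b c → a' ≡ b ⊎ a' ≡ c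
  flip₀ (inj₁ e) = inj₁ e
  flip₀ (inj₂ (inj₁ e)) = contradiction e b≢c
  flip₀ (inj₂ (inj₂ e)) = inj₂ e
  flip₁ : SomeTwoEqual a b' c → b' ≡ a ⊎ b' ≡ c
  flip₁ (inj₁ e) = inj₁ (sym e)
  flip₁ (inj₂ (inj₁ e)) = inj₂ e
  flip₁ (inj₂ (inj₂ e)) = contradiction e a≢c
  flip₂ : SomeTwoEqual a b c' → c' ≡ a ⊎ c' ≡ b
  flip₂ (inj₁ e) = contradiction e a≢b
  flip₂ (inj₂ (inj₁ e)) = inj₂ (sym e)
  flip₂ (inj₂ (inj₂ e)) = inj₁ (sym e)
  cases : a' ≡ b ⊎ a' ≡ c → b' ≡ a ⊎ b' ≡ c → c' ≡ a ⊎ c' ≡ b → ⊥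
  cases (inj₁ refl) (inj₁ refl) _ = distinct⇒¬SomeTwoEqual (≢-sym a≢b) a≢c b≢c t₀₁
  cases (inj₁ refl) (inj₂ refl) (inj₁ refl) = distinct⇒¬SomeTwoEqual b≢c (≢-sym a≢c) (≢-sym a≢b) t₀₁₂
  cases (inj₁ refl) (inj₂ refl) (inj₂ refl) = distinct⇒¬SomeTwoEqual a≢c (≢-sym b≢c) a≢b t₁₂
  cases (inj₂ refl) (inj₁ refl) (inj₁ refl) = distinct⇒¬SomeTwoEqual (≢-sym b≢c) (≢-sym a≢b) (≢-sym a≢c) t₀₂
  cases (inj₂ refl) (inj₁ refl) (inj₂ refl) = distinct⇒¬SomeTwoEqual (≢-sym a≢c) a≢b (≢-sym b≢c) t₀₁₂
  cases (inj₂ refl) (inj₂ refl) (inj₁ refl) = distinct⇒¬SomeTwoEqual (≢-sym b≢c) (≢-sym a≢b) (≢-sym a≢c) t₀₂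
  cases (inj₂ refl) (inj₂ refl) (inj₂ refl) = distinct⇒¬SomeTwoEqual a≢c (≢-sym b≢c) a≢b t₁₂

module _ {n : ℕ} (G : Graph n) where

  lowerBoundStructure-order≤2 : (∀ w → AtMostTwo (λ v → G v w)) → ∀ d → LowerBoundStructure G d → d ≤ 2
  lowerBoundStructure-order≤2 _ 0 _ = z≤n
  lowerBoundStructure-order≤2 _ 1 _ = s≤s z≤n
  lowerBoundStructure-order≤2 _ 2 _ = s≤s (s≤s z≤n)
  lowerBoundStructure-order≤2 in-degree≤2 (suc (suc (suc d))) (_ , x , x' , x-injective , _ , _ , flips-meet) =
    ⊥-elim (no-three-flips (x i₀) (x i₁) (x i₂) (x' i₀) (x' i₁) (x' i₂)
      (x-distinct λ ()) (x-distinct λ ()) (x-distinct λ ())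
      (flipped true false false (i₀ , refl)) (flipped false true false (i₁ , refl))
      (flipped false false true (i₂ , refl)) (flipped true true false (i₀ , refl))
      (flipped true false true (i₀ , refl)) (flipped false true true (i₁ , refl))
      (flipped true true true (i₀ , refl)))
    where
    x-distinct : ∀ {i j} → i ≢ j → x i ≢ x j
    x-distinct i≢j = i≢j ∘ x-injective
    i₀ i₁ i₂ : Fin (3 + d)
    i₀ = zero
    i₁ = suc zero
    i₂ = suc (suc zero)
    choice : Bool → Bool → Bool → Fin (3 + d) → Bool
    choice b₀ _ _ zero = b₀
    choice _ b₁ _ (suc zero) = b₁
    choice _ _ b₂ (suc (suc zero)) = b₂
    choice _ _ _ (suc (suc (suc _))) = false
    flipped : ∀ b₀ b₁ b₂ → (∃ λ i → choice b₀ b₁ b₂ i ≡ true) →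
      SomeTwoEqual (if b₀ then x' i₀ else x i₀) (if b₁ then x' i₁ else x i₁) (if b₂ then x' i₂ else x i₂)
    flipped b₀ b₁ b₂ some-flip =
      let w , _ , y~w = flips-meet (choice b₀ b₁ b₂) some-flip
      in in-degree≤2 w (y~w i₀) (y~w i₁) (y~w i₂)

module _ {k : ℕ} where

  Next : Fin k → Fin k → Set
  Next u v = toℕ v ≡ suc (toℕ u) ⊎ (toℕ v ≡ 0 × suc (toℕ u) ≡ k)

  Cycle⇒Next : ∀ {u v} → Cycle k u v → Next u v ⊎ Next v u
  Cycle⇒Next (inj₁ e) = inj₁ (inj₁ e)
  Cycle⇒Next (inj₂ (inj₁ e)) = inj₂ (inj₁ e)
  Cycle⇒Next (inj₂ (inj₂ (inj₁ p))) = inj₂ (inj₂ p)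
  Cycle⇒Next (inj₂ (inj₂ (inj₂ p))) = inj₁ (inj₂ p)

  Cycle-sym : ∀ {u v} → Cycle k u v → Cycle k v u
  Cycle-sym (inj₁ e) = inj₂ (inj₁ e)
  Cycle-sym (inj₂ (inj₁ e)) = inj₁ e
  Cycle-sym (inj₂ (inj₂ (inj₁ p))) = inj₂ (inj₂ (inj₂ p))
  Cycle-sym (inj₂ (inj₂ (inj₂ p))) = inj₂ (inj₂ (inj₁ p))

  private
    toℕ≢k : (v : Fin k) → toℕ v ≢ k
    toℕ≢k v e = <-irrefl e (toℕ<n v)

  Next-functional : ∀ {u v v'} → Next u v → Next u v' → v ≡ v'
  Next-functional (inj₁ e) (inj₁ e') = toℕ-injective (trans e (sym e'))
  Next-functional {v = v} (inj₁ e) (inj₂ (_ , e')) = contradiction (trans e e') (toℕ≢k v)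
  Next-functional {v' = v'} (inj₂ (_ , e)) (inj₁ e') = contradiction (trans e' e) (toℕ≢k v')
  Next-functional (inj₂ (e , _)) (inj₂ (e' , _)) = toℕ-injective (trans e (sym e'))

  Next-injective : ∀ {u u' v} → Next u v → Next u' v → u ≡ u'
  Next-injective (inj₁ e) (inj₁ e') = toℕ-injective (suc-injective (trans (sym e) e'))
  Next-injective (inj₁ e) (inj₂ (e' , _)) = contradiction (trans (sym e) e') λ ()
  Next-injective (inj₂ (e' , _)) (inj₁ e) = contradiction (trans (sym e) e') λ ()
  Next-injective (inj₂ (_ , e)) (inj₂ (_ , e')) = toℕ-injective (suc-injective (trans e (sym e')))

  Cycle-atMostTwo : ∀ {w} → AtMostTwo (Cycle k w)
  Cycle-atMostTwo w~a w~b w~c = go (Cycle⇒Next w~a) (Cycle⇒Next w~b) (Cycle⇒Next w~c)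
    where
    go : ∀ {w a b c} → Next w a ⊎ Next a w → Next w b ⊎ Next b w → Next w c ⊎ Next c w
       → SomeTwoEqual a b c
    go (inj₁ w→a) (inj₁ w→b) _ = inj₁ (Next-functional w→a w→b)
    go (inj₂ a→w) (inj₂ b→w) _ = inj₁ (Next-injective a→w b→w)
    go (inj₁ w→a) (inj₂ _) (inj₁ w→c) = inj₂ (inj₂ (Next-functional w→a w→c))
    go (inj₁ _) (inj₂ b→w) (inj₂ c→w) = inj₂ (inj₁ (Next-injective b→w c→w))
    go (inj₂ _) (inj₁ w→b) (inj₁ w→c) = inj₂ (inj₁ (Next-functional w→b w→c))
    go (inj₂ a→w) (inj₁ _) (inj₂ c→w) = inj₂ (inj₂ (Next-injective a→w c→w))

  record Steps (n : ℕ) (u v : Fin k) : Set where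
    constructor steps
    field
      windings : ℕ
      equation : toℕ u + n ≡ toℕ v + windings * k

  Next⇒Steps : ∀ {u v} → Next u v → Steps 1 u v
  Next⇒Steps {u} {v} (inj₁ v≡1+u) = steps 0 (begin
    toℕ u + 1  ≡⟨ +-comm (toℕ u) 1 ⟩
    suc (toℕ u) ≡⟨ v≡1+u ⟨
    toℕ v       ≡⟨ +-identityʳ (toℕ v) ⟨
    toℕ v + 0   ∎)
    where open ≡-Reasoning
  Next⇒Steps {u} {v} (inj₂ (v≡0 , 1+u≡k)) = steps 1 (begin
    toℕ u + 1   ≡⟨ +-comm (toℕ u) 1 ⟩
    suc (toℕ u) ≡⟨ 1+u≡k ⟩
    k           ≡⟨ +-identityʳ k ⟨
    1 * k       ≡⟨ cong (_+ 1 * k) v≡0 ⟨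
    toℕ v + 1 * k ∎)
    where open ≡-Reasoning

  Steps-trans : ∀ {m n a b c} → Steps m a b → Steps n b c → Steps (m + n) a c
  Steps-trans {m} {n} {a} {b} {c} (steps q a+m≡b+qk) (steps r b+n≡c+rk) = steps (r + q) (begin
    toℕ a + (m + n)         ≡⟨ +-assoc (toℕ a) m n ⟨
    toℕ a + m + n           ≡⟨ cong (_+ n) a+m≡b+qk ⟩
    toℕ b + q * k + n       ≡⟨ xy∙z≈xz∙y (toℕ b) (q * k) n ⟩
    toℕ b + n + q * k       ≡⟨ cong (_+ q * k) b+n≡c+rk ⟩
    toℕ c + r * k + q * k   ≡⟨ +-assoc (toℕ c) (r * k) (q * k) ⟩
    toℕ c + (r * k + q * k) ≡⟨ cong (toℕ c +_) (*-distribʳ-+ k r q) ⟨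
    toℕ c + (r + q) * k     ∎)
    where open ≡-Reasoning

  Steps-loop⇒∣ : ∀ {n u} → Steps n u u → k ∣ n
  Steps-loop⇒∣ {u = u} (steps q u+n≡u+qk) = divides q (+-cancelˡ-≡ (toℕ u) _ _ u+n≡u+qk)

  Next² : Fin k → Fin k → Set
  Next² u v = ∃ λ w → Next u w × Next w v

  Next²-functional : ∀ {u v v'} → Next² u v → Next² u v' → v ≡ v'
  Next²-functional (_ , u→w , w→v) (_ , u→w' , w'→v') with Next-functional u→w u→w'
  ... | refl = Next-functional w→v w'→v'

  Next²-injective : ∀ {u u' v} → Next² u v → Next² u' v → u ≡ u'
  Next²-injective (_ , u→w , w→v) (_ , u'→w' , w'→v) with Next-injective w→v w'→v
  ... | refl = Next-injective u→w u'→w'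

  Next²⇒Steps : ∀ {u v} → Next² u v → Steps 2 u v
  Next²⇒Steps (_ , u→w , w→v) = Steps-trans (Next⇒Steps u→w) (Next⇒Steps w→v)

  Cycle-in-atMostTwo : ∀ {w} → AtMostTwo (λ v → Cycle k v w)
  Cycle-in-atMostTwo u~w v~w x~w = Cycle-atMostTwo (Cycle-sym u~w) (Cycle-sym v~w) (Cycle-sym x~w)

  CommonNeighbour⇒Next² : ∀ {a b} → a ≢ b → CommonNeighbour (Cycle k) a b → Next² a b ⊎ Next² b a
  CommonNeighbour⇒Next² a≢b (_ , w~a , w~b) with Cycle⇒Next w~a | Cycle⇒Next w~b
  ... | inj₁ w→a | inj₁ w→b = contradiction (Next-functional w→a w→b) a≢b
  ... | inj₁ w→a | inj₂ b→w = inj₂ (_ , b→w , w→a)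
  ... | inj₂ a→w | inj₁ w→b = inj₁ (_ , a→w , w→b)
  ... | inj₂ a→w | inj₂ b→w = contradiction (Next-injective a→w b→w) a≢b

  Next²-triangle⇒∣6 : ∀ {a b c} → Next² a b → Next² b c → Next² c a → k ∣ 6
  Next²-triangle⇒∣6 a→b b→c c→a =
    Steps-loop⇒∣ (Steps-trans (Steps-trans (Next²⇒Steps a→b) (Next²⇒Steps b→c)) (Next²⇒Steps c→a))

  -- Distinctness rules out all orientations except the two cyclic ones.
  PairwiseCommonNeighbours⇒∣6 : ∀ {a b c} → a ≢ b → b ≢ c → a ≢ c
    → PairwiseCommonNeighbours (Cycle k) a b c → k ∣ 6
  PairwiseCommonNeighbours⇒∣6 a≢b b≢c a≢c (ab , bc , ac) =
    orient (CommonNeighbour⇒Next² a≢b ab) (CommonNeighbour⇒Next² b≢c bc) (CommonNeighbour⇒Next² a≢c ac)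
    where
    orient : _ → _ → _ → k ∣ 6
    orient (inj₁ a→b) (inj₁ b→c) (inj₁ a→c) = contradiction (Next²-functional a→b a→c) b≢c
    orient (inj₁ a→b) (inj₁ b→c) (inj₂ c→a) = Next²-triangle⇒∣6 a→b b→c c→a
    orient (inj₁ a→b) (inj₂ c→b) _ = contradiction (Next²-injective a→b c→b) a≢c
    orient (inj₂ b→a) (inj₁ b→c) _ = contradiction (Next²-functional b→a b→c) a≢c
    orient (inj₂ b→a) (inj₂ c→b) (inj₁ a→c) = Next²-triangle⇒∣6 a→c c→b b→a
    orient (inj₂ b→a) (inj₂ c→b) (inj₂ c→a) = contradiction (Next²-injective b→a c→a) b≢c

5+m∣6⇒≡6 : ∀ m → 5 + m ∣ 6 → 5 + m ≡ 6
5+m∣6⇒≡6 0 5∣6 = contradiction 5∣6 (from-no (5 ∣? 6))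
5+m∣6⇒≡6 1 _ = refl
5+m∣6⇒≡6 (suc (suc m)) k∣6 = contradiction k∣6 (>⇒∤ (m≤m+n 7 m))

cycle? : ∀ {k} → Decidable (Cycle k)
cycle? {k} u v =
  (toℕ v ≟ suc (toℕ u)) ⊎-dec (toℕ u ≟ suc (toℕ v))
  ⊎-dec ((toℕ u ≟ 0 ×-dec suc (toℕ v) ≟ k) ⊎-dec (toℕ v ≟ 0 ×-dec suc (toℕ u) ≟ k))

if-elim : ∀ {A : Set} (P : A → Set) (b : Bool) {u v : A}
  → (b ≡ true → P u) → (b ≡ false → P v) → P (if b then u else v)
if-elim P true on-true _ = on-true refl
if-elim P false _ on-false = on-false refl

module Cycle≥5 (m : ℕ) where

  private
    G : Graph (5 + m)
    G = Cycle (5 + m)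

    G? : Decidable G
    G? = cycle?

    last : Fin (5 + m)
    last = fromℕ (4 + m)

    last~0 : G last (# 0)
    last~0 = inj₂ (inj₂ (inj₂ (refl , cong suc (toℕ-fromℕ (4 + m)))))

    private-neighbour-of-4 : ∃ λ w → G (# 4) w × ¬ G (# 2) w
    private-neighbour-of-4 = go m
      where
      go : ∀ m → ∃ λ w → Cycle (5 + m) (# 4) w × ¬ Cycle (5 + m) (# 2) w
      go zero = # 0 , from-yes (cycle? {5} (# 4) (# 0)) , from-no (cycle? {5} (# 2) (# 0))
      go (suc m) = # 5 , from-yes (cycle? {6 + m} (# 4) (# 5)) , from-no (cycle? {6 + m} (# 2) (# 5))

  lowerBoundStructure : LowerBoundStructure G 2
  lowerBoundStructure = L , x , x' , x-injective , incomparable , no-common , flips-common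
    where
    L : Subset (5 + m)
    L = outside ∷ inside ∷ outside ∷ inside ∷ outside ∷ ∅
    x x' : Fin 2 → Fin (5 + m)
    x zero = # 0
    x (suc zero) = # 4
    x' _ = # 2

    x-injective : ∀ {i j} → x i ≡ x j → i ≡ j
    x-injective {zero} {zero} _ = refl
    x-injective {suc zero} {suc zero} _ = refl
    x-injective {zero} {suc zero} ()
    x-injective {suc zero} {zero} ()

    incomparable : ∀ i → Incomparable G (x i) (x' i)
    incomparable zero =
        private-neighbour⇒¬NbhdSub G (Cycle-sym last~0) (from-no (G? (# 2) last))
      , private-neighbour⇒¬NbhdSub G (from-yes (G? (# 2) (# 3))) (from-no (G? (# 0) (# 3)))
    incomparable (suc zero) =
      let w , 4~w , 2≁w = private-neighbour-of-4
      in private-neighbour⇒¬NbhdSub G 4~w 2≁w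
       , private-neighbour⇒¬NbhdSub G (from-yes (G? (# 2) (# 1))) (from-no (G? (# 4) (# 1)))

    no-common : ¬ CommonNbrInL G x L
    no-common (_ , there here , x~1) = from-no (G? (# 4) (# 1)) (x~1 (suc zero))
    no-common (_ , there (there (there here)) , x~3) = from-no (G? (# 0) (# 3)) (x~3 zero)
    no-common (_ , there (there (there (there (there w∈∅)))) , _) = ∉⊥ w∈∅

    no-flip : ∀ {c : Fin 2 → Bool} → c zero ≡ false → c (suc zero) ≡ false → ¬ (∃ λ i → c i ≡ true)
    no-flip c₀ _ (zero , c₀') = contradiction (trans (sym c₀') c₀) λ ()
    no-flip _ c₁ (suc zero , c₁') = contradiction (trans (sym c₁') c₁) λ ()

    flips-common : ∀ (c : Fin 2 → Bool) → (∃ λ i → c i ≡ true)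
      → CommonNbrInL G (λ i → if c i then x' i else x i) L
    flips-common c some-flip with c (suc zero) in c₁
    ... | true = # 1 , there here , λ where
      zero → if-elim (λ y → G y (# 1)) (c zero)
        (λ _ → from-yes (G? (# 2) (# 1))) (λ _ → from-yes (G? (# 0) (# 1)))
      (suc zero) → if-elim (λ y → G y (# 1)) (c (suc zero)) (λ _ → from-yes (G? (# 2) (# 1)))
        λ c₁≡false → contradiction (trans (sym c₁) c₁≡false) λ ()
    ... | false = # 3 , there (there (there here)) , λ where
      zero → if-elim (λ y → G y (# 3)) (c zero) (λ _ → from-yes (G? (# 2) (# 3)))
        λ c₀≡false → contradiction some-flip (no-flip c₀≡false c₁)
      (suc zero) → if-elim (λ y → G y (# 3)) (c (suc zero))
        (λ _ → from-yes (G? (# 2) (# 3))) (λ _ → from-yes (G? (# 4) (# 3)))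

  minimal-pair : ∃ λ L → ∃ λ S → MinimalNoCommonNeighbor G S L × ∣ S ∣ ≡ 2
  minimal-pair = L , S , minimal-from-witnesses G non-neighbour neighbour-of-rest , cong (2 +_) (∣⊥∣≡0 m)
    where
    L S : Subset (5 + m)
    L = inside ∷ outside ∷ outside ∷ inside ∷ outside ∷ ∅
    S = outside ∷ inside ∷ inside ∷ outside ∷ outside ∷ ∅

    non-neighbour : ∀ {w} → w ∈ L → ∃ λ s → s ∈ S × ¬ G w s
    non-neighbour here = # 2 , there (there here) , from-no (G? (# 0) (# 2))
    non-neighbour (there (there (there here))) = # 1 , there here , from-no (G? (# 3) (# 1))
    non-neighbour (there (there (there (there (there w∈∅))))) = contradiction w∈∅ ∉⊥

    neighbour-of-rest : ∀ {y} → y ∈ S → ∃ λ w → w ∈ L × (∀ {s} → s ∈ S → s ≢ y → G w s)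
    neighbour-of-rest (there here) = # 3 , there (there (there here)) , λ where
      (there here) s≢y → contradiction refl s≢y
      (there (there here)) _ → from-yes (G? (# 3) (# 2))
      (there (there (there (there (there s∈∅))))) _ → contradiction s∈∅ ∉⊥
    neighbour-of-rest (there (there here)) = # 0 , here , λ where
      (there here) _ → from-yes (G? (# 0) (# 1))
      (there (there here)) s≢y → contradiction refl s≢y
      (there (there (there (there (there s∈∅))))) _ → contradiction s∈∅ ∉⊥
    neighbour-of-rest (there (there (there (there (there y∈∅))))) = contradiction y∈∅ ∉⊥

cycle₆-minimal-triple : ∃ λ L → ∃ λ S → MinimalNoCommonNeighbor (Cycle 6) S L × ∣ S ∣ ≡ 3
cycle₆-minimal-triple = L , S , minimal-from-witnesses (Cycle 6) non-neighbour neighbour-of-rest , refl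
  where
  C₆? : Decidable (Cycle 6)
  C₆? = cycle?

  L S : Subset 6
  L = outside ∷ inside ∷ outside ∷ inside ∷ outside ∷ inside ∷ []
  S = inside ∷ outside ∷ inside ∷ outside ∷ inside ∷ outside ∷ []

  non-neighbour : ∀ {w} → w ∈ L → ∃ λ s → s ∈ S × ¬ Cycle 6 w s
  non-neighbour (there here) = # 4 , there (there (there (there here))) , from-no (C₆? (# 1) (# 4))
  non-neighbour (there (there (there here))) = # 0 , here , from-no (C₆? (# 3) (# 0))
  non-neighbour (there (there (there (there (there here))))) = # 2 , there (there here) , from-no (C₆? (# 5) (# 2))

  neighbour-of-rest : ∀ {y} → y ∈ S → ∃ λ w → w ∈ L × (∀ {s} → s ∈ S → s ≢ y → Cycle 6 w s)
  neighbour-of-rest here = # 3 , there (there (there here)) , λ where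
    here s≢y → contradiction refl s≢y
    (there (there here)) _ → from-yes (C₆? (# 3) (# 2))
    (there (there (there (there here)))) _ → from-yes (C₆? (# 3) (# 4))
    (there (there (there (there (there (there ())))))) _
  neighbour-of-rest (there (there here)) = # 5 , there (there (there (there (there here)))) , λ where
    here _ → from-yes (C₆? (# 5) (# 0))
    (there (there here)) s≢y → contradiction refl s≢y
    (there (there (there (there here)))) _ → from-yes (C₆? (# 5) (# 4))
    (there (there (there (there (there (there ())))))) _
  neighbour-of-rest (there (there (there (there (there (there ()))))))
  neighbour-of-rest (there (there (there (there here)))) = # 1 , there here , λ where
    here _ → from-yes (C₆? (# 1) (# 0))
    (there (there here)) _ → from-yes (C₆? (# 1) (# 2))
    (there (there (there (there here)))) s≢y → contradiction refl s≢y
    (there (there (there (there (there (there ())))))) _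

cycle-dStar : ∀ m → DStarIs (Cycle (5 + m)) 2
cycle-dStar m =
  Cycle≥5.lowerBoundStructure m , lowerBoundStructure-order≤2 (Cycle (5 + m)) (λ _ → Cycle-in-atMostTwo)

cycle-cStar : ∀ m → 5 + m ≢ 6 → CStarIs (Cycle (5 + m)) 2
cycle-cStar m k≢6 = Cycle≥5.minimal-pair m , minimal-size≤2 (Cycle (5 + m)) no-triangle
  where
  no-triangle : ∀ {a b c} → a ≢ b → b ≢ c → a ≢ c → ¬ PairwiseCommonNeighbours (Cycle (5 + m)) a b c
  no-triangle a≢b b≢c a≢c = k≢6 ∘ 5+m∣6⇒≡6 m ∘ PairwiseCommonNeighbours⇒∣6 a≢b b≢c a≢c

mainTheorem8 : (∀ (k : ℕ) → 5 ≤ k → ¬ k ≡ 6 →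
    DStarIs (Cycle k) 2 × CStarIs (Cycle k) 2)
    × (CStarIs (Cycle 6) 3 × DStarIs (Cycle 6) 2)
mainTheorem8 =
  cycles≥5 , (cycle₆-minimal-triple , minimal-size≤3 (Cycle 6) (λ _ → Cycle-atMostTwo)) , cycle-dStar 1
  where
  cycles≥5 : ∀ k → 5 ≤ k → ¬ k ≡ 6 → DStarIs (Cycle k) 2 × CStarIs (Cycle k) 2
  cycles≥5 k 5≤k k≢6 with m≤n⇒∃[o]m+o≡n 5≤k
  ... | m , refl = cycle-dStar m , cycle-cStar m k≢6
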